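{- For every $n\ge -1$: (i) $|\breve{\mathrm{Cil}}_0\Gamma_+[n]|_k = n+2$ if $k=n$ and $=0$ if $k\ne n$; (ii) $|\mathrm{Cil}_0\,\partial\Gamma_+[n]| = \sum_{i=-1}^{n-1}\binom{n+1}{i+1}\,|\breve{\mathrm{Cil}}_0\Gamma_+[i]|$; (iii) $|\mathrm{Cil}_0\Gamma_+[n]| = |\mathrm{Cil}_0\,\partial\Gamma_+[n]| + |\breve{\mathrm{Cil}}_0\Gamma_+[n]|$.
   Context: $[n]=\{0<\dots<n\}$ for $n\ge0$, $[-1]=\emptyset$; $\Gamma_+[n]_p$ is the set of strictly increasing maps $[p]\to[n]$ ($p\ge-1$; $\Gamma_+[n]_{ -1}=\{\emptyset\}$). For $\sigma\in\Gamma_+[n]_p$, $\tau\in\Gamma_+[n]_q$ write $\sigma\prec\tau$ if $\sigma([p])\cap\tau([q])=\emptyset$ and $\sigma(i)<\tau(j)$ for all $i\in[p]$, $j\in[q]$. The $0$-cylinder $\mathrm{Cil}_0\Gamma_+[n]$ is the augmented semi-simplicial set with $\mathrm{Cil}_0\Gamma_+[n]_m=\{(\sigma,\tau)\in\Gamma_+[n]_p\times\Gamma_+[n]_q: p,q\ge-1,\ p+q=m-1,\ \sigma\prec\tau\}$, with faces $d_i(\sigma,\tau)=(d_i\sigma,\tau)$ for $0\le i\le p$ and $(\sigma,d_{i-p-1}\tau)$ for $p+1\le i\le m$. $\mathrm{Cil}_0\,\partial\Gamma_+[n]$ is the sub-object of pairs with $\sigma([p])\cup\tau([q])\subsetneq[n]$,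 and $\breve{\mathrm{Cil}}_0\Gamma_+[n]=\mathrm{Cil}_0\Gamma_+[n]\setminus\mathrm{Cil}_0\,\partial\Gamma_+[n]$ is the set of pairs with $\sigma([p])\cup\tau([q])=[n]$. $|Y|$ denotes the sequence $(|Y_m|)_{m\ge-1}$; sums of sequences are termwise. -}

module Defs where

open import Data.Nat using (ℕ; zero; suc; _+_; _*_)
open import Data.Nat.Combinatorics using (_C_)
open import Data.Fin using (Fin) renaming (_<_ to _<F_)
open import Data.List using (List; length; lookup)
open import Data.List.Membership.Propositional using (_∈_)
open import Data.Product using (Σ; _×_; _,_; proj₁)
open import Data.Sum using (_⊎_)
open import Relation.Nullary using (¬_)
open import Relation.Binary using (Setoid)
open import Relation.Binary.PropositionalEquality using (_≡_; _≢_)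
import Relation.Binary.PropositionalEquality as Eq
import Relation.Binary.Construct.On as On
open import Function.Bundles using (Inverse)

-- INDEX SHIFT CONVENTION: the paper's indices n, p, q, m ≥ -1 are encoded by
-- the natural numbers N = n+1, P = p+1, Q = q+1, M = m+1, i.e. by the
-- cardinalities of the finite ordinals [n], [p], [q], [m].  So [n] = Fin N.

-- A strictly increasing map σ : [p] → [n] is recorded by its list of values
-- (σ(0), …, σ(p)), a list of elements of Fin N of length P = p+1,
-- together with strict monotonicity.
StrictInc : {N : ℕ} → List (Fin N) → Set
StrictInc σ = ∀ (i j : Fin (length σ)) → i <F j → lookup σ i <F lookup σ j

_≺_ : {N : ℕ} → List (Fin N) → List (Fin N) → Set
σ ≺ τ = (∀ i j → lookup σ i ≢ lookup τ j) × (∀ i j → lookup σ i <F lookup τ j)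

Covers : {N : ℕ} → List (Fin N) → List (Fin N) → Set
Covers {N} σ τ = ∀ (x : Fin N) → x ∈ σ ⊎ x ∈ τ

-- The M-simplices (M = m+1) of Cil₀ Γ₊[n] (N = n+1) satisfying an extra
-- condition R on the pair (σ , τ): pairs (σ, τ) ∈ Γ₊[n]_p × Γ₊[n]_q with
-- p + q = m - 1 (i.e. P + Q = M) and σ ≺ τ.
CilCells : (N M : ℕ) → (List (Fin N) → List (Fin N) → Set) → Set
CilCells N M R =
  Σ (List (Fin N) × List (Fin N)) λ { (σ , τ) →
    StrictInc σ × StrictInc τ × (length σ + length τ ≡ M) × σ ≺ τ × R σ τ }

-- A cell is determined by the pair of maps (σ , τ); the proof components are
-- irrelevant, so cells are compared by their underlying pair.
CilSetoid : (N M : ℕ) → (List (Fin N) → List (Fin N) → Set) → Setoid _ _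
CilSetoid N M R = On.setoid {B = CilCells N M R} (Eq.setoid _) proj₁

Cil0 Cil0∂ Cil0˘ : (N M : ℕ) → Setoid _ _
Cil0  N M = CilSetoid N M (λ _ _ → Data.Unit.⊤) where import Data.Unit
Cil0∂ N M = CilSetoid N M (λ σ τ → ¬ Covers σ τ)
Cil0˘ N M = CilSetoid N M (λ σ τ → Covers σ τ)

HasCard : ∀ {a ℓ} → Setoid a ℓ → ℕ → Set _
HasCard S k = Inverse S (Eq.setoid (Fin k))

∑< : ℕ → (ℕ → ℕ) → ℕ
∑< zero    f = 0
∑< (suc n) f = ∑< n f + f n

-- An m-cell (σ , τ) of Cil₀ Γ₊[n] is the same as a strictly increasing list
-- L = σ ++ τ of length m+1 in [n] together with the cut point length σ ≤ m+1;
-- the cell is interior exactly when L covers [n].  There are (n+1 choose m+1)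
-- such lists, and the only covering one is [n] itself.  Hence the interior has
-- n+2 cells, all in degree n, and the boundary has (n+1 choose m+1)·(m+2) cells
-- in each degree m < n, which is the single surviving term i = m of the sum in
-- (ii).  Part (iii) is the decidable splitting of cells into interior and
-- boundary ones.
module Submission where

open import Data.Empty using (⊥; ⊥-elim)
open import Data.Fin
  using (Fin; zero; suc; toℕ; fromℕ<; splitAt; join; combine; remQuot)
  renaming (_<_ to _<ᶠ_)
import Data.Fin.Properties as Fin
open import Data.Fin.Permutation using (↔⇒≡)
open import Data.List using (List; []; _∷_; length; lookup; map; _++_; take; drop; head; allFin)
open import Data.List.Properties
  using (length-map; length-++; length-take; length-tabulate; take++drop≡id; map-tabulate)
open import Data.List.Membership.Propositional using (_∈_)
open import Data.List.Membership.Propositional.Properties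
  using (∈-lookup; ∈-allFin; ∈-++⁺ˡ; ∈-++⁺ʳ; ∈-++⁻)
import Data.List.Membership.DecPropositional as DecMembership
open import Data.List.Relation.Unary.All as All using (All; []; _∷_)
import Data.List.Relation.Unary.All.Properties as AllProp
open import Data.List.Relation.Unary.AllPairs as AllPairs using (AllPairs; []; _∷_)
import Data.List.Relation.Unary.AllPairs.Properties as AllPairsProp
open import Data.List.Relation.Unary.Any using (here; there)
open import Data.Maybe using (just)
open import Data.Nat using (ℕ; zero; suc; _+_; _*_; _≤_; _<_; s≤s; z<s; s<s; s<s⁻¹; s≤s⁻¹)
open import Data.Nat.Combinatorics using (_C_; nCn≡1; k>n⇒nCk≡0; nCk+nC[k+1]≡[n+1]C[k+1])
open import Data.Nat.Properties
  using (<-trans; <-cmp; n<1+n; m<n⇒m<1+n; <⇒≢; ≤⇒≯; m≤m+n; m≤n⇒m⊓n≡m;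
         suc-injective; +-identityʳ; *-identityˡ; *-zeroʳ)
open import Data.Product using (Σ; _×_; _,_; proj₁; proj₂)
open import Data.Sum using (_⊎_; inj₁; inj₂; [_,_])
open import Data.Unit using (⊤; tt)
open import Function using (id; _∘_)
open import Function.Bundles using (Inverse)
import Function.Construct.Composition as Composition
import Function.Construct.Symmetry as Symmetry
open import Level using (0ℓ)
open import Relation.Binary using (Setoid; Tri; tri<; tri≈; tri>)
import Relation.Binary.Construct.On as On
open import Relation.Binary.PropositionalEquality
  using (_≡_; _≢_; refl; sym; trans; cong; cong₂; subst; ≢-sym; module ≡-Reasoning)
import Relation.Binary.PropositionalEquality as ≡
open import Relation.Nullary using (¬_; Dec; yes; no)
open import Relation.Nullary.Decidable using (_⊎-dec_)

open import Defs

Subsetoid : {A : Set} → (A → Set) → Setoid 0ℓ 0ℓ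
Subsetoid {A} P = On.setoid {B = Σ A P} (≡.setoid A) proj₁

-- Counts {a | P a} up to equality of the underlying elements; proofs of P are ignored.
record Card {A : Set} (P : A → Set) (k : ℕ) : Set where
  field
    to      : ∀ a → P a → Fin k
    from    : Fin k → A
    from-P  : ∀ i → P (from i)
    to-from : ∀ i p → to (from i) p ≡ i
    from-to : ∀ a p → from (to a p) ≡ a

module _ {A : Set} {P : A → Set} {k : ℕ} (E : Card P k) where
  open Card E

  to-from-≡ : ∀ {i a} → from i ≡ a → (p : P a) → to a p ≡ i
  to-from-≡ refl p = to-from _ p

  Card⇒HasCard : HasCard (Subsetoid P) k
  Card⇒HasCard = record
    { to        = λ (a , p) → to a p
    ; from      = λ i → from i , from-P i
    ; to-cong   = λ { {a , p} {.a , q} refl → sym (to-from-≡ (from-to a p) q) }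
    ; from-cong = λ { refl → refl }
    ; inverse   = (λ { {i} {a , p} i≡ → to-from-≡ (sym i≡) p })
                , (λ { {a , p} refl → from-to a p })
    }

HasCard⇒Card : {A : Set} {P : A → Set} {k : ℕ} → HasCard (Subsetoid P) k → Card P k
HasCard⇒Card I = record
  { to      = λ a p → I.to (a , p)
  ; from    = λ i → proj₁ (I.from i)
  ; from-P  = λ i → proj₂ (I.from i)
  ; to-from = λ i p → I.inverseˡ {x = i} {y = proj₁ (I.from i) , p} refl
  ; from-to = λ a p → I.inverseʳ {x = a , p} refl
  }
  where module I = Inverse I

HasCard-unique : ∀ {a ℓ} {S : Setoid a ℓ} {m n : ℕ} → HasCard S m → HasCard S n → m ≡ n
HasCard-unique I J = ↔⇒≡ (Composition.inverse (Symmetry.inverse I) J)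

module _ {A B : Set} {P : A → Set} {Q : B → Set} {k : ℕ} where

  Card-bijection : (f : A → B) (g : B → A) →
                   (∀ a → P a → Q (f a)) → (∀ b → Q b → P (g b)) →
                   (∀ a → P a → g (f a) ≡ a) → (∀ b → Q b → f (g b) ≡ b) →
                   Card P k → Card Q k
  Card-bijection f g P⇒Q Q⇒P gf fg E = record
    { to      = λ b q → E.to (g b) (Q⇒P b q)
    ; from    = f ∘ E.from
    ; from-P  = λ i → P⇒Q _ (E.from-P i)
    ; to-from = λ i q → to-from-≡ E (sym (gf _ (E.from-P i))) _
    ; from-to = λ b q → trans (cong f (E.from-to (g b) (Q⇒P b q))) (fg b q)
    }
    where module E = Card E

Card-cong : {A : Set} {P Q : A → Set} {k : ℕ} →
            (∀ a → P a → Q a) → (∀ a → Q a → P a) → Card P k → Card Q k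
Card-cong P⇒Q Q⇒P = Card-bijection id id P⇒Q Q⇒P (λ _ _ → refl) (λ _ _ → refl)

Card-empty : {A : Set} {P : A → Set} → (∀ a → ¬ P a) → Card P 0
Card-empty ¬P = record
  { to = λ a p → ⊥-elim (¬P a p) ; from = λ () ; from-P = λ ()
  ; to-from = λ () ; from-to = λ a p → ⊥-elim (¬P a p) }

Card-singleton : {A : Set} {P : A → Set} (a₀ : A) → P a₀ → (∀ a → P a → a ≡ a₀) → Card P 1
Card-singleton a₀ p₀ unique = record
  { to = λ _ _ → zero ; from = λ _ → a₀ ; from-P = λ { zero → p₀ }
  ; to-from = λ { zero _ → refl } ; from-to = λ a p → sym (unique a p) }

Card-1-unique : {A : Set} {P : A → Set} → Card P 1 → ∀ {a b} → P a → P b → a ≡ b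
Card-1-unique E {a} {b} p q = begin
  a                ≡⟨ E.from-to a p ⟨
  E.from (E.to a p) ≡⟨ cong E.from (Fin1-unique (E.to a p) (E.to b q)) ⟩
  E.from (E.to b q) ≡⟨ E.from-to b q ⟩
  b                ∎
  where
  module E = Card E
  open ≡-Reasoning
  Fin1-unique : (i j : Fin 1) → i ≡ j
  Fin1-unique zero zero = refl

Card-≤ : ∀ m → Card (_≤ m) (suc m)
Card-≤ m = record
  { to      = λ p p≤m → fromℕ< (s≤s p≤m)
  ; from    = toℕ
  ; from-P  = Fin.toℕ≤pred[n]
  ; to-from = λ i _ → Fin.fromℕ<-toℕ i _
  ; from-to = λ p p≤m → Fin.toℕ-fromℕ< (s≤s p≤m)
  }

module _ {A B : Set} {P : A → Set} {Q : B → Set} {a b : ℕ} (E : Card P a) (F : Card Q b) where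
  private
    module E = Card E
    module F = Card F

  Card-× : Card (λ (x , y) → P x × Q y) (a * b)
  Card-× = record
    { to      = λ (x , y) (p , q) → combine (E.to x p) (F.to y q)
    ; from    = λ i → let (i₁ , i₂) = remQuot b i in E.from i₁ , F.from i₂
    ; from-P  = λ i → E.from-P _ , F.from-P _
    ; to-from = λ i (p , q) → trans (cong₂ combine (E.to-from _ p) (F.to-from _ q))
                                    (Fin.combine-remQuot {a} b i)
    ; from-to = λ (x , y) (p , q) →
        let i≡ = Fin.remQuot-combine {a} {b} (E.to x p) (F.to y q) in
        cong₂ _,_ (trans (cong (E.from ∘ proj₁) i≡) (E.from-to x p))
                  (trans (cong (F.from ∘ proj₂) i≡) (F.from-to y q))
    }

module _ {A : Set} {P Q R : A → Set} {a b : ℕ} (E : Card P a) (F : Card Q b)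
         (disjoint : ∀ x → P x → Q x → ⊥) (split : ∀ x → R x → P x ⊎ Q x)
         (P⇒R : ∀ x → P x → R x) (Q⇒R : ∀ x → Q x → R x) where
  private
    module E = Card E
    module F = Card F

    index : ∀ x → P x ⊎ Q x → Fin a ⊎ Fin b
    index x (inj₁ p) = inj₁ (E.to x p)
    index x (inj₂ q) = inj₂ (F.to x q)

    element : Fin a ⊎ Fin b → A
    element = [ E.from , F.from ]

    element-R : ∀ s → R (element s)
    element-R (inj₁ i) = P⇒R _ (E.from-P i)
    element-R (inj₂ i) = Q⇒R _ (F.from-P i)

    index-element : ∀ s w → index (element s) w ≡ s
    index-element (inj₁ i) (inj₁ p) = cong inj₁ (E.to-from i p)
    index-element (inj₁ i) (inj₂ q) = ⊥-elim (disjoint _ (E.from-P i) q)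
    index-element (inj₂ i) (inj₁ p) = ⊥-elim (disjoint _ p (F.from-P i))
    index-element (inj₂ i) (inj₂ q) = cong inj₂ (F.to-from i q)

    element-index : ∀ x w → element (index x w) ≡ x
    element-index x (inj₁ p) = E.from-to x p
    element-index x (inj₂ q) = F.from-to x q

  Card-⊎ : Card R (a + b)
  Card-⊎ = record
    { to      = λ x r → join a b (index x (split x r))
    ; from    = element ∘ splitAt a
    ; from-P  = element-R ∘ splitAt a
    ; to-from = λ i r → trans (cong (join a b) (index-element (splitAt a i) (split _ r)))
                              (Fin.join-splitAt a b i)
    ; from-to = λ x r → trans (cong element (Fin.splitAt-join a b (index x (split x r))))
                              (element-index x (split x r))
    }

∑<-zero : ∀ {n} {f : ℕ → ℕ} → (∀ i → i < n → f i ≡ 0) → ∑< n f ≡ 0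
∑<-zero {zero}  _ = refl
∑<-zero {suc n} f≡0 = cong₂ _+_ (∑<-zero (λ i i<n → f≡0 i (m<n⇒m<1+n i<n))) (f≡0 n (n<1+n n))

∑<-single : ∀ {n k} {f : ℕ → ℕ} → k < n → (∀ i → i ≢ k → f i ≡ 0) → ∑< n f ≡ f k
∑<-single {suc n} {k} {f} k<1+n f≡0 with <-cmp k n
... | tri< k<n _ _  = trans (cong₂ _+_ (∑<-single k<n f≡0) (f≡0 n (≢-sym (<⇒≢ k<n))))
                            (+-identityʳ (f k))
... | tri≈ _ refl _ = cong (_+ f k) (∑<-zero (λ i i<k → f≡0 i (<⇒≢ i<k)))
... | tri> _ _ n<k  = ⊥-elim (≤⇒≯ (s≤s⁻¹ k<1+n) n<k)

-- Strictly increasing lists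

Sorted : ∀ {n} → List (Fin n) → Set
Sorted = AllPairs _<ᶠ_

SortedOfLength : ∀ {n} → ℕ → List (Fin n) → Set
SortedOfLength k L = Sorted L × length L ≡ k

All-lookup⁻ : {A : Set} {P : A → Set} (xs : List A) → (∀ i → P (lookup xs i)) → All P xs
All-lookup⁻ []       _  = []
All-lookup⁻ (x ∷ xs) Pxs = Pxs zero ∷ All-lookup⁻ xs (Pxs ∘ suc)

StrictInc⇒Sorted : ∀ {n} (σ : List (Fin n)) → StrictInc σ → Sorted σ
StrictInc⇒Sorted []      _   = []
StrictInc⇒Sorted (_ ∷ σ) inc =
  All-lookup⁻ σ (λ j → inc zero (suc j) z<s) ∷ StrictInc⇒Sorted σ (λ i j → inc (suc i) (suc j) ∘ s<s)

Sorted⇒StrictInc : ∀ {n} {σ : List (Fin n)} → Sorted σ → StrictInc σ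
Sorted⇒StrictInc (x<σ ∷ _) zero    (suc j) _   = All.lookup x<σ (∈-lookup j)
Sorted⇒StrictInc (_ ∷ σ<)  (suc i) (suc j) i<j = Sorted⇒StrictInc σ< i j (s<s⁻¹ i<j)

≺⇒All< : ∀ {n} {σ τ : List (Fin n)} → σ ≺ τ → All (λ x → All (x <ᶠ_) τ) σ
≺⇒All< {σ = σ} {τ} (_ , σ<τ) = All-lookup⁻ σ (λ i → All-lookup⁻ τ (σ<τ i))

All<⇒≺ : ∀ {n} {σ τ : List (Fin n)} → All (λ x → All (x <ᶠ_) τ) σ → σ ≺ τ
All<⇒≺ {σ = σ} {τ} σ<τ = (λ i j → Fin.<⇒≢ (lt i j)) , lt
  where
  lt : ∀ i j → lookup σ i <ᶠ lookup τ j
  lt i j = All.lookup (All.lookup σ<τ (∈-lookup i)) (∈-lookup j)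

AllPairs-++⁻ : {A : Set} {R : A → A → Set} (xs : List A) {ys : List A} → AllPairs R (xs ++ ys) →
               AllPairs R xs × AllPairs R ys × All (λ x → All (R x) ys) xs
AllPairs-++⁻ []       Rys             = [] , Rys , []
AllPairs-++⁻ (x ∷ xs) (Rx[xs++ys] ∷ R[xs++ys]) =
  let (Rxs , Rys , Rxsys) = AllPairs-++⁻ xs R[xs++ys]
      (Rxxs , Rxys)       = AllProp.++⁻ xs Rx[xs++ys]
  in (Rxxs ∷ Rxs) , Rys , (Rxys ∷ Rxsys)

Positive : ∀ {n} → List (Fin (suc n)) → Set
Positive {n} = All (_<ᶠ_ {suc n} zero)

unshift : ∀ {n} → List (Fin (suc n)) → List (Fin n)
unshift []           = []
unshift (zero  ∷ xs) = unshift xs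
unshift (suc x ∷ xs) = x ∷ unshift xs

unshift-shift : ∀ {n} (xs : List (Fin n)) → unshift (map suc xs) ≡ xs
unshift-shift []       = refl
unshift-shift (x ∷ xs) = cong (x ∷_) (unshift-shift xs)

shift-unshift : ∀ {n} {xs : List (Fin (suc n))} → Positive xs → map suc (unshift xs) ≡ xs
shift-unshift []                     = refl
shift-unshift {xs = suc x ∷ _} (_ ∷ pos) = cong (suc x ∷_) (shift-unshift pos)

∈-unshift : ∀ {n} {y : Fin n} {xs : List (Fin (suc n))} → suc y ∈ xs → y ∈ unshift xs
∈-unshift {xs = zero  ∷ _} (there y∈) = ∈-unshift y∈
∈-unshift {xs = suc _ ∷ _} (here refl) = here refl
∈-unshift {xs = suc _ ∷ _} (there y∈) = there (∈-unshift y∈)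

positive-shift : ∀ {n} (xs : List (Fin n)) → Positive (map suc xs)
positive-shift xs = AllProp.map⁺ (All.universal (λ _ → z<s) xs)

sorted-shift : ∀ {n} {xs : List (Fin n)} → Sorted xs → Sorted (map suc xs)
sorted-shift = AllPairsProp.map⁺ ∘ AllPairs.map s<s

sorted-unshift : ∀ {n} {xs : List (Fin (suc n))} → Positive xs → Sorted xs → Sorted (unshift xs)
sorted-unshift pos sorted =
  AllPairs.map s<s⁻¹ (AllPairsProp.map⁻ (subst Sorted (sym (shift-unshift pos)) sorted))

length-unshift : ∀ {n} {xs : List (Fin (suc n))} → Positive xs → length (unshift xs) ≡ length xs
length-unshift {xs = xs} pos = trans (sym (length-map suc (unshift xs))) (cong length (shift-unshift pos))

sorted-positive : ∀ {n} {x : Fin n} {xs : List (Fin (suc n))} → Sorted (suc x ∷ xs) → Positive (suc x ∷ xs)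
sorted-positive (x<xs ∷ _) = z<s ∷ All.map (Fin.<-trans z<s) x<xs

zero∉positive : ∀ {n} {xs : List (Fin (suc n))} → Positive xs → ¬ zero ∈ xs
zero∉positive {n} pos 0∈ = Fin.<⇒≢ {i = zero {n}} (All.lookup pos 0∈) refl

-- Pascal's rule, split according to whether the list starts with zero.
sorted-count : ∀ n k → Card (SortedOfLength {n} k) (n C k)
sorted-count n       zero    = Card-singleton [] ([] , refl) λ { [] _ → refl ; (_ ∷ _) (_ , ()) }
sorted-count zero    (suc k) = Card-empty λ { [] (_ , ()) ; (() ∷ _) }
sorted-count (suc n) (suc k) =
  subst (Card _) (nCk+nC[k+1]≡[n+1]C[k+1] n k)
        (Card-⊎ starting-at-zero positive disjoint split (λ _ → proj₁) (λ _ → proj₁))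
  where
  starting-at-zero : Card (λ L → SortedOfLength (suc k) L × head L ≡ just zero) (n C k)
  starting-at-zero = Card-bijection (λ L → zero ∷ map suc L) unshift
    (λ L (sorted , len) →
      (positive-shift L ∷ sorted-shift sorted , cong suc (trans (length-map suc L) len)) , refl)
    (λ { (zero ∷ xs) ((pos ∷ sorted , len) , _) →
           sorted-unshift pos sorted , trans (length-unshift pos) (suc-injective len)
       ; [] (_ , ()) ; (suc _ ∷ _) (_ , ()) })
    (λ L _ → unshift-shift L)
    (λ { (zero ∷ xs) ((pos ∷ _ , _) , _) → cong (zero ∷_) (shift-unshift pos)
       ; [] (_ , ()) ; (suc _ ∷ _) (_ , ()) })
    (sorted-count n k)

  positive : Card (λ L → SortedOfLength (suc k) L × Positive L) (n C suc k)
  positive = Card-bijection (map suc) unshift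
    (λ L (sorted , len) → (sorted-shift sorted , trans (length-map suc L) len) , positive-shift L)
    (λ L ((sorted , len) , pos) → sorted-unshift pos sorted , trans (length-unshift pos) len)
    (λ L _ → unshift-shift L)
    (λ L (_ , pos) → shift-unshift pos)
    (sorted-count n (suc k))

  disjoint : ∀ L → SortedOfLength (suc k) L × head L ≡ just zero →
             SortedOfLength (suc k) L × Positive L → ⊥
  disjoint (zero ∷ _) _ (_ , pos) = zero∉positive pos (here refl)

  split : ∀ L → SortedOfLength (suc k) L →
          SortedOfLength (suc k) L × head L ≡ just zero ⊎ SortedOfLength (suc k) L × Positive L
  split (zero  ∷ _) s = inj₁ (s , refl)
  split (suc _ ∷ _) s = inj₂ (s , sorted-positive (proj₁ s))

-- Covering lists

Covering : ∀ {n} → List (Fin n) → Set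
Covering {n} L = ∀ (x : Fin n) → x ∈ L

sorted-allFin : ∀ {n} → SortedOfLength n (allFin n)
sorted-allFin = AllPairsProp.tabulate⁺-< id , length-tabulate id

covering-sorted≡allFin : ∀ {n} {L : List (Fin n)} → Sorted L → Covering L → L ≡ allFin n
covering-sorted≡allFin {zero}  {[]}        _          _   = refl
covering-sorted≡allFin {suc n} {[]}        _          cov with () ← cov zero
covering-sorted≡allFin {suc n} {suc _ ∷ _} sorted     cov = ⊥-elim (zero∉positive (sorted-positive sorted) (cov zero))
covering-sorted≡allFin {suc n} {zero ∷ xs} (pos ∷ sorted) cov = begin
  zero ∷ xs                     ≡⟨ cong (zero ∷_) (shift-unshift pos) ⟨
  zero ∷ map suc (unshift xs)   ≡⟨ cong (λ L → zero ∷ map suc L) (covering-sorted≡allFin (sorted-unshift pos sorted) cov′) ⟩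
  zero ∷ map suc (allFin n)     ≡⟨ cong (zero ∷_) (map-tabulate id suc) ⟩
  allFin (suc n)                ∎
  where
  open ≡-Reasoning
  cov′ : Covering (unshift xs)
  cov′ y with cov (suc y)
  ... | there y∈ = ∈-unshift y∈

length-covering-sorted : ∀ {n} {L : List (Fin n)} → Sorted L → Covering L → length L ≡ n
length-covering-sorted sorted cov = trans (cong length (covering-sorted≡allFin sorted cov)) (proj₂ sorted-allFin)

-- n C n = 1, so allFin n is the only sorted list of length n.
sorted-of-full-length-covers : ∀ {n} {L : List (Fin n)} → SortedOfLength n L → Covering L
sorted-of-full-length-covers {n} s =
  subst Covering (sym (Card-1-unique (subst (Card _) (nCn≡1 n) (sorted-count n n)) s sorted-allFin)) ∈-allFin

covering-count : ∀ n → Card (λ L → SortedOfLength {n} n L × Covering L) 1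
covering-count n = Card-singleton (allFin n) (sorted-allFin , ∈-allFin)
  (λ L ((sorted , _) , cov) → covering-sorted≡allFin sorted cov)

covering-count-≢ : ∀ {n k} → k ≢ n → Card (λ L → SortedOfLength {n} k L × Covering L) 0
covering-count-≢ k≢n = Card-empty λ L ((sorted , len) , cov) →
  k≢n (trans (sym len) (length-covering-sorted sorted cov))

noncovering-count-≢ : ∀ {n k} → k ≢ n → Card (λ L → SortedOfLength {n} k L × ¬ Covering L) (n C k)
noncovering-count-≢ {n} {k} k≢n = Card-cong
  (λ L (sorted , len) → (sorted , len) , λ cov → k≢n (trans (sym len) (length-covering-sorted sorted cov)))
  (λ L → proj₁)
  (sorted-count n k)

noncovering-count : ∀ n → Card (λ L → SortedOfLength {n} n L × ¬ Covering L) 0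
noncovering-count n = Card-empty λ L (s , ¬cov) → ¬cov (sorted-of-full-length-covers s)

-- Cells of the cylinder

CellAt : ∀ {n} → (List (Fin n) → List (Fin n) → Set) → ℕ → List (Fin n) × List (Fin n) → Set
CellAt R m (σ , τ) = StrictInc σ × StrictInc τ × (length σ + length τ ≡ m) × σ ≺ τ × R σ τ

take-length-++ : {A : Set} (xs ys : List A) → take (length xs) (xs ++ ys) ≡ xs
take-length-++ []       _  = refl
take-length-++ (x ∷ xs) ys = cong (x ∷_) (take-length-++ xs ys)

drop-length-++ : {A : Set} (xs ys : List A) → drop (length xs) (xs ++ ys) ≡ ys
drop-length-++ []       _  = refl
drop-length-++ (_ ∷ xs) ys = drop-length-++ xs ys

-- A cell (σ , τ) is the sorted list σ ++ τ together with the cut point length σ.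
cells-count : ∀ {n m c} {R : List (Fin n) → List (Fin n) → Set} {R′ : List (Fin n) → Set} →
              (∀ σ τ → R σ τ → R′ (σ ++ τ)) → (∀ σ τ → R′ (σ ++ τ) → R σ τ) →
              Card (λ L → SortedOfLength m L × R′ L) c → Card (CellAt R m) (c * suc m)
cells-count {n} {m} {R = R} {R′} R⇒R′ R′⇒R E =
  Card-bijection cut glue cut-cell glue-cell glue-cut cut-glue (Card-× E (Card-≤ m))
  where
  cut : List (Fin n) × ℕ → List (Fin n) × List (Fin n)
  cut (L , p) = take p L , drop p L

  glue : List (Fin n) × List (Fin n) → List (Fin n) × ℕ
  glue (σ , τ) = σ ++ τ , length σ

  cut-cell : ∀ x → (SortedOfLength m (proj₁ x) × R′ (proj₁ x)) × proj₂ x ≤ m → CellAt R m (cut x)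
  cut-cell (L , p) (((sorted , len) , r) , _) =
    let L≡ = take++drop≡id p L
        (sσ , sτ , σ<τ) = AllPairs-++⁻ (take p L) (subst Sorted (sym L≡) sorted)
    in Sorted⇒StrictInc sσ , Sorted⇒StrictInc sτ
     , trans (sym (length-++ (take p L))) (trans (cong length L≡) len)
     , All<⇒≺ σ<τ , R′⇒R _ _ (subst R′ (sym L≡) r)

  glue-cell : ∀ y → CellAt R m y → (SortedOfLength m (proj₁ (glue y)) × R′ (proj₁ (glue y))) × proj₂ (glue y) ≤ m
  glue-cell (σ , τ) (incσ , incτ , len , σ≺τ , r) =
    ( (AllPairsProp.++⁺ (StrictInc⇒Sorted σ incσ) (StrictInc⇒Sorted τ incτ) (≺⇒All< σ≺τ)
      , trans (length-++ σ) len)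
    , R⇒R′ σ τ r)
    , subst (length σ ≤_) len (m≤m+n _ _)

  glue-cut : ∀ x → (SortedOfLength m (proj₁ x) × R′ (proj₁ x)) × proj₂ x ≤ m → glue (cut x) ≡ x
  glue-cut (L , p) (((_ , len) , _) , p≤m) =
    cong₂ _,_ (take++drop≡id p L) (trans (length-take p L) (m≤n⇒m⊓n≡m (subst (p ≤_) (sym len) p≤m)))

  cut-glue : ∀ y → CellAt R m y → cut (glue y) ≡ y
  cut-glue (σ , τ) _ = cong₂ _,_ (take-length-++ σ τ) (drop-length-++ σ τ)

Covers⇒Covering : ∀ {n} (σ τ : List (Fin n)) → Covers σ τ → Covering (σ ++ τ)
Covers⇒Covering σ τ cov x = [ ∈-++⁺ˡ , ∈-++⁺ʳ σ ] (cov x)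

Covering⇒Covers : ∀ {n} (σ τ : List (Fin n)) → Covering (σ ++ τ) → Covers σ τ
Covering⇒Covers σ τ cov x = ∈-++⁻ σ (cov x)

interior-count : ∀ {n k c} → Card (λ L → SortedOfLength {n} k L × Covering L) c →
                 Card (CellAt Covers k) (c * suc k)
interior-count = cells-count Covers⇒Covering Covering⇒Covers

boundary-cells-count : ∀ {n k c} → Card (λ L → SortedOfLength {n} k L × ¬ Covering L) c →
                       Card (CellAt (λ σ τ → ¬ Covers σ τ) k) (c * suc k)
boundary-cells-count = cells-count
  (λ σ τ ¬cov cov → ¬cov (Covering⇒Covers σ τ cov))
  (λ σ τ ¬cov cov → ¬cov (Covers⇒Covering σ τ cov))

covers? : ∀ {n} (σ τ : List (Fin n)) → Dec (Covers σ τ)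
covers? {n} σ τ = Fin.all? (λ x → (x ∈? σ) ⊎-dec (x ∈? τ))
  where open DecMembership (Fin._≟_ {n})

Cil0˘-top : ∀ n → HasCard (Cil0˘ n n) (suc n)
Cil0˘-top n = Card⇒HasCard (subst (Card _) (*-identityˡ (suc n)) (interior-count (covering-count n)))

Cil0˘-off-top : ∀ {n k} → k ≢ n → HasCard (Cil0˘ n k) 0
Cil0˘-off-top k≢n = Card⇒HasCard (interior-count (covering-count-≢ k≢n))

Cil0∂-off-top : ∀ {n k} → k ≢ n → HasCard (Cil0∂ n k) ((n C k) * suc k)
Cil0∂-off-top k≢n = Card⇒HasCard (boundary-cells-count (noncovering-count-≢ k≢n))

Cil0∂-top : ∀ n → HasCard (Cil0∂ n n) 0
Cil0∂-top n = Card⇒HasCard (boundary-cells-count (noncovering-count n))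

Cil0∂-count : ∀ n k {g : ℕ → ℕ} → (∀ i → i ≢ k → g i ≡ 0) → g k ≡ suc k →
              HasCard (Cil0∂ n k) (∑< n (λ i → (n C i) * g i))
Cil0∂-count n k {g} g≡0 g≡1+k = by-cases (<-cmp k n)
  where
  term≡0 : ∀ i → i ≢ k → (n C i) * g i ≡ 0
  term≡0 i i≢k = trans (cong ((n C i) *_) (g≡0 i i≢k)) (*-zeroʳ (n C i))

  by-cases : Tri (k < n) (k ≡ n) (n < k) → HasCard (Cil0∂ n k) (∑< n (λ i → (n C i) * g i))
  by-cases (tri< k<n k≢n _) =
    subst (HasCard (Cil0∂ n k))
          (sym (trans (∑<-single k<n term≡0) (cong ((n C k) *_) g≡1+k)))
          (Cil0∂-off-top k≢n)
  by-cases (tri≈ _ refl _) =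
    subst (HasCard (Cil0∂ n k)) (sym (∑<-zero (λ i i<k → term≡0 i (<⇒≢ i<k)))) (Cil0∂-top n)
  by-cases (tri> _ k≢n n<k) =
    subst (HasCard (Cil0∂ n k))
          (trans (cong (_* suc k) (k>n⇒nCk≡0 n<k)) (sym (∑<-zero (λ i i<n → term≡0 i (<⇒≢ (<-trans i<n n<k))))))
          (Cil0∂-off-top k≢n)

Cil0-split : ∀ {n k a b} → HasCard (Cil0∂ n k) a → HasCard (Cil0˘ n k) b → HasCard (Cil0 n k) (a + b)
Cil0-split {n} {k} ∂ ˘ = Card⇒HasCard
  (Card-⊎ (HasCard⇒Card ∂) (HasCard⇒Card ˘) disjoint split forget forget)
  where
  disjoint : ∀ x → CellAt (λ σ τ → ¬ Covers σ τ) k x → CellAt Covers k x → ⊥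
  disjoint _ (_ , _ , _ , _ , ¬cov) (_ , _ , _ , _ , cov) = ¬cov cov

  split : ∀ x → CellAt (λ _ _ → ⊤) k x → CellAt (λ σ τ → ¬ Covers σ τ) k x ⊎ CellAt Covers k x
  split (σ , τ) (incσ , incτ , len , σ≺τ , _) with covers? σ τ
  ... | yes cov = inj₂ (incσ , incτ , len , σ≺τ , cov)
  ... | no ¬cov = inj₁ (incσ , incτ , len , σ≺τ , ¬cov)

  forget : ∀ {R : List (Fin n) → List (Fin n) → Set} x → CellAt R k x → CellAt (λ _ _ → ⊤) k x
  forget _ (incσ , incτ , len , σ≺τ , _) = incσ , incτ , len , σ≺τ , tt

mainTheorem5 : ∀ (N : ℕ) →
      ((∀ K → K ≡ N → HasCard (Cil0˘ N K) (suc N))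
        × (∀ K → K ≢ N → HasCard (Cil0˘ N K) 0))
      × (∀ (c : ℕ → ℕ → ℕ) → (∀ I K → HasCard (Cil0˘ I K) (c I K)) →
          ∀ K → HasCard (Cil0∂ N K) (∑< N (λ I → (N C I) * c I K)))
      × (∀ K a b → HasCard (Cil0∂ N K) a → HasCard (Cil0˘ N K) b →
          HasCard (Cil0 N K) (a + b))
mainTheorem5 N =
  ((λ { K refl → Cil0˘-top N }) , λ K → Cil0˘-off-top) ,
  (λ c c-card K → Cil0∂-count N K
     (λ I I≢K → HasCard-unique (c-card I K) (Cil0˘-off-top (≢-sym I≢K)))
     (HasCard-unique (c-card K K) (Cil0˘-top K))) ,
  λ K a b → Cil0-split
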